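{- For commands $c,c'$ and relations $\mathcal P,\mathcal Q$: if $\models\langle c\mid c'\rangle:\mathcal P\Rrightarrow\mathcal Q$ then $\models c\mid c':\mathcal P\leadsto_\forall\mathcal Q$.
   Context: Stores are total functions from (integer and boolean) variables to values of the appropriate type; $\mathsf{Store}$ is the set of stores; relations are subsets of $\mathsf{Store}\times\mathsf{Store}$. Commands are $c::=\mathsf{skip}\mid x:=e\mid\mathsf{hav}\ x\mid\mathsf{assert}\ p\mid c;c\mid\mathsf{if}\ e\ \mathsf{then}\ c\ \mathsf{else}\ c\mid\mathsf{while}\ e\ \mathsf{do}\ c$ with standard big-step semantics $c/s\Downarrow\phi$, $\phi\in\mathsf{Store}\cup\{\mathsf{fail}\}$ ($\mathsf{hav}\ x$ assigns any value; $\mathsf{assert}\ p$ fails outside $p$; failure propagates). The embed bicom $\langle c\mid c'\rangle$ has semantics: $\langle c|c'\rangle/(s,s')\Downarrow\mathsf{fail}$ if $c/s\Downarrow\mathsf{fail}$, or if $c/s\Downarrow t$ and $c'/s'\Downarrow\mathsf{fail}$; $\langle c|c'\rangle/(s,s')\Downarrow(t,t')$ if $c/s\Downarrow t$ and $c'/s'\Downarrow t'$ (and no other outcomes). $\models\langle c|c'\rangle:\mathcal P\Rrightarrow\mathcal Q$ means: for all $(s,s')\in\mathcal P$, not $\langle c|c'\rangle/(s,s')\Downarrow\mathsf{fail}$, and $(t,t')\in\mathcal Q$ whenever $\langle c|c'\rangle/(s,s')\Downarrow(t,t')$. $\models c\mid c':\mathcal P\leadsto_\forall\mathcal Q$ means: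 for all $s,s',\phi,\phi'$ with $(s,s')\in\mathcal P$, $c/s\Downarrow\phi$, $c'/s'\Downarrow\phi'$, we have $\phi\ne\mathsf{fail}$, $\phi'\ne\mathsf{fail}$ and $(\phi,\phi')\in\mathcal Q$. -}

module Defs where

open import Data.Nat using (ℕ)
open import Data.Integer using (ℤ)
open import Data.Bool using (Bool; true; false)
open import Data.Product using (_×_; _,_)
open import Relation.Nullary using (¬_)
open import Relation.Binary.PropositionalEquality using (_≡_; _≢_)
open import Data.Empty using (⊥)
open import Level using (0ℓ; suc)

data Var : Set where
  ivar : ℕ → Var
  bvar : ℕ → Var

Val : Var → Set
Val (ivar _) = ℤ
Val (bvar _) = Bool

Store : Set
Store = (x : Var) → Val x

Rel : Set₁
Rel = Store → Store → Set

Pred : Set₁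
Pred = Store → Set

-- Expressions are represented semantically: a well-typed expression of type
-- of variable x is a function from stores to values of that type;
-- boolean (guard) expressions are functions Store → Bool.
Expr : Var → Set
Expr x = Store → Val x

BExpr : Set
BExpr = Store → Bool

open import Data.Nat using (_≟_)
open import Relation.Nullary using (yes; no)

update : Store → (x : Var) → Val x → Store
update s (ivar n) v (ivar m) with n ≟ m
... | yes _ = v
... | no  _ = s (ivar m)
update s (ivar n) v (bvar m) = s (bvar m)
update s (bvar n) v (ivar m) = s (ivar m)
update s (bvar n) v (bvar m) with n ≟ m
... | yes _ = v
... | no  _ = s (bvar m)

data Cmd : Set₁ where
  skip   : Cmd
  assign : (x : Var) → Expr x → Cmd
  hav    : Var → Cmd
  assert : Pred → Cmd
  _⨾_    : Cmd → Cmd → Cmd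
  ifte   : BExpr → Cmd → Cmd → Cmd
  while  : BExpr → Cmd → Cmd

data Outcome : Set where
  ok   : Store → Outcome
  fail : Outcome

data _/_⇓_ : Cmd → Store → Outcome → Set₁ where
  ⇓skip     : ∀ {s} → skip / s ⇓ ok s
  ⇓assign   : ∀ {x e s} → assign x e / s ⇓ ok (update s x (e s))
  ⇓hav      : ∀ {x s} (v : Val x) → hav x / s ⇓ ok (update s x v)
  ⇓assert   : ∀ {p s} → p s → assert p / s ⇓ ok s
  ⇓assertF  : ∀ {p s} → ¬ p s → assert p / s ⇓ fail
  ⇓seq      : ∀ {c₁ c₂ s t φ} → c₁ / s ⇓ ok t → c₂ / t ⇓ φ → (c₁ ⨾ c₂) / s ⇓ φ
  ⇓seqF     : ∀ {c₁ c₂ s} → c₁ / s ⇓ fail → (c₁ ⨾ c₂) / s ⇓ fail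
  ⇓ifT      : ∀ {e c₁ c₂ s φ} → e s ≡ true → c₁ / s ⇓ φ → ifte e c₁ c₂ / s ⇓ φ
  ⇓ifF      : ∀ {e c₁ c₂ s φ} → e s ≡ false → c₂ / s ⇓ φ → ifte e c₁ c₂ / s ⇓ φ
  ⇓whileF   : ∀ {e c s} → e s ≡ false → while e c / s ⇓ ok s
  ⇓whileT   : ∀ {e c s t φ} → e s ≡ true → c / s ⇓ ok t → while e c / t ⇓ φ → while e c / s ⇓ φ
  ⇓whileTF  : ∀ {e c s} → e s ≡ true → c / s ⇓ fail → while e c / s ⇓ fail

data BiOutcome : Set where
  ok2   : Store → Store → BiOutcome
  fail2 : BiOutcome

data ⟨_∣_⟩/_,_⇓_ : Cmd → Cmd → Store → Store → BiOutcome → Set₁ where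
  embF₁ : ∀ {c c' s s'} → c / s ⇓ fail → ⟨ c ∣ c' ⟩/ s , s' ⇓ fail2
  embF₂ : ∀ {c c' s s' t} → c / s ⇓ ok t → c' / s' ⇓ fail → ⟨ c ∣ c' ⟩/ s , s' ⇓ fail2
  embOK : ∀ {c c' s s' t t'} → c / s ⇓ ok t → c' / s' ⇓ ok t' → ⟨ c ∣ c' ⟩/ s , s' ⇓ ok2 t t'

⊨emb : Cmd → Cmd → Rel → Rel → Set₁
⊨emb c c' P Q = ∀ s s' → P s s' →
  (¬ (⟨ c ∣ c' ⟩/ s , s' ⇓ fail2)) ×
  (∀ t t' → ⟨ c ∣ c' ⟩/ s , s' ⇓ ok2 t t' → Q t t')

InQ : Rel → Outcome → Outcome → Set
InQ Q (ok t) (ok t') = Q t t'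
InQ Q _      _       = ⊥

⊨∀ : Cmd → Cmd → Rel → Rel → Set₁
⊨∀ c c' P Q = ∀ s s' φ φ' → P s s' → c / s ⇓ φ → c' / s' ⇓ φ' →
  (φ ≢ fail) × (φ' ≢ fail) × InQ Q φ φ'

module Submission where

open import Defs
open import Data.Product using (_,_; proj₁; proj₂)
open import Data.Empty using (⊥-elim)

data EmbedRun (c c' : Cmd) (s s' : Store) : Outcome → Outcome → Set₁ where
  embed-ok   : ∀ {t t'} → ⟨ c ∣ c' ⟩/ s , s' ⇓ ok2 t t' → EmbedRun c c' s s' (ok t) (ok t')
  embed-fail : ∀ {φ φ'} → ⟨ c ∣ c' ⟩/ s , s' ⇓ fail2 → EmbedRun c c' s s' φ φ'

embed-run : ∀ {c c' s s' φ φ'} → c / s ⇓ φ → c' / s' ⇓ φ' → EmbedRun c c' s s' φ φ'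
embed-run {φ = ok _} {ok _} d d' = embed-ok (embOK d d')
embed-run {φ = ok _} {fail} d d' = embed-fail (embF₂ d d')
embed-run {φ = fail}        d d' = embed-fail (embF₁ d)

lemma4p7 : (c c' : Cmd) (P Q : Rel) → ⊨emb c c' P Q → ⊨∀ c c' P Q
lemma4p7 c c' P Q H s s' φ φ' p d d' with embed-run d d'
... | embed-ok run   = (λ ()) , (λ ()) , proj₂ (H s s' p) _ _ run
... | embed-fail run = ⊥-elim (proj₁ (H s s' p) run)
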